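{- Let $\mathcal{C}$ be a concept class of functions $X\to\{\pm1\}$, let $S=((x_1,y_1),\dots,(x_n,y_n))\in(X\times\{\pm1\})^n$ be any dataset and $\varepsilon\ge 0$, and let $\bar h:X\to[-1,1]$ satisfy $\ell_S(c,\bar h)\le\varepsilon$ for all $c\in\mathcal{C}$, where \[ \ell_S(c,\bar h)=\mathbb{E}_{(\mathbf{x},\mathbf{y})\sim\mathrm{Unif}(S)}\big[c(\mathbf{x})\mathbf{y}(2-\bar h(\mathbf{x})\mathbf{y})-\bar h(\mathbf{x})\mathbf{y}\big]. \] Then the randomized function $\mathbf{h}=\mathrm{Rad}(\bar h)$ satisfies \[ \Pr_{\mathbf{i}\sim\mathrm{Unif}(I),\mathbf{h}}[\mathbf{h}(x_{\mathbf{i}})\ne y_{\mathbf{i}}]\le\frac{\eta+\varepsilon/2}{2(1-\eta)} \] simultaneously for all $\eta\in[0,1)$ and all index sets $I\subseteq[n]$ of size $(1-\eta)n$ for which some $c\in\mathcal{C}$ is fully consistent with $S_I$ (i.e., $c(x_i)=y_i$ for all $i\in I$).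
   Context: $\mathrm{Rad}(\bar h)$ is the randomized hypothesis outputting $+1$ on $x$ with probability $\frac{1+\bar h(x)}2$ and $-1$ otherwise. $S_I$ denotes the subsequence of $S$ with indices in $I$. -}

module Defs where

open import Level using (Level; _⊔_) renaming (suc to lsuc)
open import Algebra.Bundles using (CommutativeRing)
open import Relation.Binary.Structures using (IsTotalOrder)
open import Relation.Nullary using (¬_)
open import Data.Nat using (ℕ; zero; suc)
open import Data.Fin using (Fin)
open import Data.Fin.Subset using (Subset; inside; outside)
open import Data.Vec using (lookup)
open import Data.Sign using (Sign)
import Data.Sign as Sgn
open import Data.Product using (_×_; proj₁; proj₂)

-- All quantities in the
-- claim (h̄, ε, η, losses, probabilities over finite uniform distributions)
-- are finite field expressions, so we state the claim over an arbitrary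
-- ordered field.
record OrderedField (c ℓ₁ ℓ₂ : Level) : Set (lsuc (c ⊔ ℓ₁ ⊔ ℓ₂)) where
  field
    commutativeRing : CommutativeRing c ℓ₁
  open CommutativeRing commutativeRing public
  field
    _≤_         : Carrier → Carrier → Set ℓ₂
    isTotalOrder : IsTotalOrder _≈_ _≤_
    +-mono-≤    : ∀ {x y} z → x ≤ y → (x + z) ≤ (y + z)
    *-nonneg    : ∀ {x y} → 0# ≤ x → 0# ≤ y → 0# ≤ (x * y)
    0≉1         : ¬ (0# ≈ 1#)
    _⁻¹         : Carrier → Carrier
    ⁻¹-inverse  : ∀ x → ¬ (x ≈ 0#) → (x * (x ⁻¹)) ≈ 1#

  infix 4 _<_ _≤_
  _<_ : Carrier → Carrier → Set (ℓ₁ ⊔ ℓ₂)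
  x < y = (x ≤ y) × ¬ (x ≈ y)

  infixl 7 _/_
  _/_ : Carrier → Carrier → Carrier
  x / y = x * (y ⁻¹)

  2# : Carrier
  2# = 1# + 1#

  fromℕ : ℕ → Carrier
  fromℕ zero    = 0#
  fromℕ (suc n) = 1# + fromℕ n

  ∑ : (n : ℕ) → (Fin n → Carrier) → Carrier
  ∑ zero    f = 0#
  ∑ (suc n) f = f Fin.zero + ∑ n (λ i → f (Fin.suc i))
    where import Data.Fin as Fin

  ⟦_⟧ : Sign → Carrier
  ⟦ Sgn.+ ⟧ = 1#
  ⟦ Sgn.- ⟧ = - 1#

  loss : {a : Level} {X : Set a} {n : ℕ} → (Fin n → X × Sign) →
         (X → Sign) → (X → Carrier) → Carrier
  loss {n = n} S c h̄ =
    ∑ n (λ i → let x = proj₁ (S i) ; y = ⟦ proj₂ (S i) ⟧ in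
           (⟦ c x ⟧ * y) * (2# - h̄ x * y) - h̄ x * y) / fromℕ n

  -- Pr[Rad(h̄)(x) ≠ y], where Rad(h̄)(x) = +1 w.p. (1 + h̄ x)/2, −1 otherwise
  radErr : {a : Level} {X : Set a} → (X → Carrier) → X → Sign → Carrier
  radErr h̄ x Sgn.+ = 1# - (1# + h̄ x) / 2#
  radErr h̄ x Sgn.- = (1# + h̄ x) / 2#

  errPr : {a : Level} {X : Set a} {n : ℕ} → (Fin n → X × Sign) →
          (X → Carrier) → Subset n → Carrier
  errPr {n = n} S h̄ I =
    ∑ n (λ i → indicator (lookup I i) (radErr h̄ (proj₁ (S i)) (proj₂ (S i))))
      / fromℕ (Data.Fin.Subset.∣ I ∣)
    where
      import Data.Fin.Subset
      indicator : Data.Fin.Subset.Side → Carrier → Carrier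
      indicator inside  v = v
      indicator outside v = 0#

-- Write T i for the i-th summand of ℓ_S(c, h̄) and r i = Pr[Rad(h̄)(x i) ≠ y i] = (1 - h̄(x i) y i) / 2.
-- As a polynomial identity, T i + 2 = (1 + c(x i) y i) (2 - h̄(x i) y i).  The second factor is
-- nonnegative since |h̄| ≤ 1, and the first is 0 or 2.  So T i + 2 ≥ 0 for every i, and for i ∈ I,
-- where c(x i) = y i, it equals 4 r i + 2.  Summing over all samples,
-- 4 ∑_{i∈I} r i + 2 |I| ≤ n ℓ_S(c, h̄) + 2 n ≤ (ε + 2) n.  With |I| = (1 - η) n this gives
-- ∑_{i∈I} r i ≤ (ε + 2 η) n / 4, and dividing by |I| gives the claimed error rate.
module Submission where

open import Defs
open import Level using (Level)
open import Data.Nat using (ℕ; NonZero)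
open import Data.Fin using (Fin)
open import Data.Fin.Subset using (Subset; _∈_; ∣_∣)
open import Data.Sign using (Sign)
open import Data.Product using (_×_; Σ; proj₁; proj₂)
open import Relation.Binary.PropositionalEquality using (_≡_)

open import Algebra.Bundles using (CommutativeRing)
open import Data.Nat using (zero; suc)
open import Data.Integer using (+_)
open import Data.Fin.Subset using (Side; inside; outside)
open import Data.Vec using ([]; _∷_; lookup)
open import Data.Vec.Properties using (lookup⇒[]=)
import Data.Vec.Functional as Vector
import Data.Sign as Sign
open import Data.Product using (_,_)
open import Data.Sum using (inj₁; inj₂)
open import Relation.Nullary using (¬_)
import Relation.Binary.PropositionalEquality as ≡
open import Relation.Binary.Structures using (IsTotalOrder)

-- The library ring solver normalises coefficients in a ring whose equality it can decide; for an
-- arbitrary commutative ring that ring is ℤ, acting through its canonical map.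
module IntegerEmbedding {c ℓ} (R : CommutativeRing c ℓ) where
  open import Data.Nat as ℕ using ()
  open import Data.Nat.Properties using (+-suc)
  open import Data.Integer as ℤ using (ℤ; -[1+_]; _⊖_; _◃_; sign)
  open import Data.Integer.Properties using ([1+m]⊖[1+n]≡m⊖n; ◃-inverse)
  open import Algebra.Solver.Ring.AlmostCommutativeRing
    using (fromCommutativeRing; _-Raw-AlmostCommutative⟶_)
  open CommutativeRing R
  open import Algebra.Properties.Ring ring using (-0#≈0#; -‿involutive; -‿+-comm; -1*x≈-x)
  open import Algebra.Properties.CommutativeSemigroup +-commutativeSemigroup
    using () renaming (interchange to +-interchange)
  open import Algebra.Properties.CommutativeSemigroup *-commutativeSemigroup
    using () renaming (interchange to *-interchange)
  open import Algebra.Properties.Semiring.Mult.TCOptimised semiring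
    using (1+×; ×-homo-+; ×1-homo-*) renaming (_×_ to _×ₙ_)
  open import Relation.Binary.Reasoning.Setoid setoid

  fromSign : Sign → Carrier
  fromSign Sign.+ = 1#
  fromSign Sign.- = - 1#

  fromℤ : ℤ → Carrier
  fromℤ (+ n)    = n ×ₙ 1#
  fromℤ -[1+ n ] = - (suc n ×ₙ 1#)

  fromℤ-homo-neg : ∀ i → fromℤ (ℤ.- i) ≈ - fromℤ i
  fromℤ-homo-neg (+ zero)  = sym -0#≈0#
  fromℤ-homo-neg (+ suc n) = refl
  fromℤ-homo-neg -[1+ n ]  = sym (-‿involutive _)

  1+x-[1+y]≈x-y : ∀ x y → (1# + x) - (1# + y) ≈ x - y
  1+x-[1+y]≈x-y x y = begin
    (1# + x) - (1# + y)     ≈⟨ +-congˡ (-‿+-comm 1# y) ⟨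
    (1# + x) + (- 1# + - y) ≈⟨ +-interchange 1# x (- 1#) (- y) ⟩
    (1# - 1#) + (x - y)     ≈⟨ +-congʳ (-‿inverseʳ 1#) ⟩
    0# + (x - y)            ≈⟨ +-identityˡ _ ⟩
    x - y                   ∎

  fromℤ-homo-⊖ : ∀ m n → fromℤ (m ⊖ n) ≈ m ×ₙ 1# - n ×ₙ 1#
  fromℤ-homo-⊖ zero    zero    = sym (-‿inverseʳ 0#)
  fromℤ-homo-⊖ zero    (suc n) = sym (+-identityˡ _)
  fromℤ-homo-⊖ (suc m) zero    = sym (trans (+-congˡ -0#≈0#) (+-identityʳ _))
  fromℤ-homo-⊖ (suc m) (suc n) = begin
    fromℤ (suc m ⊖ suc n)         ≡⟨ ≡.cong fromℤ ([1+m]⊖[1+n]≡m⊖n m n) ⟩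
    fromℤ (m ⊖ n)                 ≈⟨ fromℤ-homo-⊖ m n ⟩
    m ×ₙ 1# - n ×ₙ 1#               ≈⟨ 1+x-[1+y]≈x-y _ _ ⟨
    (1# + m ×ₙ 1#) - (1# + n ×ₙ 1#) ≈⟨ +-cong (1+× m 1#) (-‿cong (1+× n 1#)) ⟨
    suc m ×ₙ 1# - suc n ×ₙ 1#       ∎

  fromℤ-homo-+ : ∀ i j → fromℤ (i ℤ.+ j) ≈ fromℤ i + fromℤ j
  fromℤ-homo-+ (+ m)    (+ n)    = ×-homo-+ 1# m n
  fromℤ-homo-+ (+ m)    -[1+ n ] = fromℤ-homo-⊖ m (suc n)
  fromℤ-homo-+ -[1+ m ] (+ n)    = trans (fromℤ-homo-⊖ n (suc m)) (+-comm _ _)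
  fromℤ-homo-+ -[1+ m ] -[1+ n ] = begin
    - (suc (suc (m ℕ.+ n)) ×ₙ 1#)     ≡⟨ ≡.cong (λ k → - (k ×ₙ 1#)) (≡.sym (+-suc (suc m) n)) ⟩
    - ((suc m ℕ.+ suc n) ×ₙ 1#)       ≈⟨ -‿cong (×-homo-+ 1# (suc m) (suc n)) ⟩
    - (suc m ×ₙ 1# + suc n ×ₙ 1#)     ≈⟨ -‿+-comm _ _ ⟨
    - (suc m ×ₙ 1#) + - (suc n ×ₙ 1#) ∎

  fromSign-homo-* : ∀ s t → fromSign (s Sign.* t) ≈ fromSign s * fromSign t
  fromSign-homo-* Sign.+ t      = sym (*-identityˡ _)
  fromSign-homo-* Sign.- Sign.+ = sym (*-identityʳ _)
  fromSign-homo-* Sign.- Sign.- = sym (trans (-1*x≈-x (- 1#)) (-‿involutive 1#))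

  fromℤ-homo-◃ : ∀ s n → fromℤ (s ◃ n) ≈ fromSign s * (n ×ₙ 1#)
  fromℤ-homo-◃ s      zero    = sym (zeroʳ _)
  fromℤ-homo-◃ Sign.+ (suc n) = sym (*-identityˡ _)
  fromℤ-homo-◃ Sign.- (suc n) = sym (-1*x≈-x _)

  fromℤ-sign-abs : ∀ i → fromℤ i ≈ fromSign (sign i) * (ℤ.∣ i ∣ ×ₙ 1#)
  fromℤ-sign-abs i =
    trans (reflexive (≡.cong fromℤ (≡.sym (◃-inverse i)))) (fromℤ-homo-◃ (sign i) ℤ.∣ i ∣)

  fromℤ-homo-* : ∀ i j → fromℤ (i ℤ.* j) ≈ fromℤ i * fromℤ j
  fromℤ-homo-* i j = begin
    fromℤ ((sign i Sign.* sign j) ◃ (ℤ.∣ i ∣ ℕ.* ℤ.∣ j ∣))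
      ≈⟨ fromℤ-homo-◃ (sign i Sign.* sign j) (ℤ.∣ i ∣ ℕ.* ℤ.∣ j ∣) ⟩
    fromSign (sign i Sign.* sign j) * ((ℤ.∣ i ∣ ℕ.* ℤ.∣ j ∣) ×ₙ 1#)
      ≈⟨ *-cong (fromSign-homo-* (sign i) (sign j)) (×1-homo-* ℤ.∣ i ∣ ℤ.∣ j ∣) ⟩
    (fromSign (sign i) * fromSign (sign j)) * ((ℤ.∣ i ∣ ×ₙ 1#) * (ℤ.∣ j ∣ ×ₙ 1#))
      ≈⟨ *-interchange _ _ _ _ ⟩
    (fromSign (sign i) * (ℤ.∣ i ∣ ×ₙ 1#)) * (fromSign (sign j) * (ℤ.∣ j ∣ ×ₙ 1#))
      ≈⟨ *-cong (fromℤ-sign-abs i) (fromℤ-sign-abs j) ⟨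
    fromℤ i * fromℤ j ∎

  fromℤ-homomorphism : ℤ.+-*-rawRing -Raw-AlmostCommutative⟶ fromCommutativeRing R
  fromℤ-homomorphism = record
    { ⟦_⟧    = fromℤ
    ; +-homo = fromℤ-homo-+
    ; *-homo = fromℤ-homo-*
    ; -‿homo = fromℤ-homo-neg
    ; 0-homo = refl
    ; 1-homo = refl
    }

module ℤ-CoefficientRingSolver {c ℓ} (R : CommutativeRing c ℓ) where
  import Data.Integer as ℤ
  open import Data.Maybe using (Maybe; map)
  open import Relation.Binary.Consequences using (dec⇒weaklyDec)
  open import Algebra.Solver.Ring.AlmostCommutativeRing using (fromCommutativeRing)
  open CommutativeRing R using (_≈_; reflexive)
  open IntegerEmbedding R using (fromℤ; fromℤ-homomorphism)

  fromℤ-weaklyDec : ∀ i j → Maybe (fromℤ i ≈ fromℤ j)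
  fromℤ-weaklyDec i j = map (λ i≡j → reflexive (≡.cong fromℤ i≡j)) (dec⇒weaklyDec ℤ._≟_ i j)

  open import Algebra.Solver.Ring
    ℤ.+-*-rawRing (fromCommutativeRing R) fromℤ-homomorphism fromℤ-weaklyDec public

  -- With the optimised _×_ of fromℤ these denote 0#, 1# and 2# = 1# + 1# on the nose.
  :0 :1 :2 : ∀ {k} → Polynomial k
  :0 = con (+ 0)
  :1 = con (+ 1)
  :2 = con (+ 2)

module OrderedFieldProperties {c ℓ₁ ℓ₂} (F : OrderedField c ℓ₁ ℓ₂) where
  open OrderedField F
  open IsTotalOrder isTotalOrder
    using (≲-respˡ-≈; ≲-respʳ-≈; total; antisym) renaming (refl to ≤-refl; trans to ≤-trans)
  open import Algebra.Properties.Ring ring using (x∙y⁻¹≈ε⇒x≈y)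
  open ℤ-CoefficientRingSolver commutativeRing using (solve; _:=_; _:+_; _:-_; _:*_; :0)
  open import Relation.Binary.Reasoning.Setoid setoid

  ≤-resp-≈ : ∀ {x x′ y y′} → x ≈ x′ → y ≈ y′ → x ≤ y → x′ ≤ y′
  ≤-resp-≈ x≈x′ y≈y′ x≤y = ≲-respˡ-≈ x≈x′ (≲-respʳ-≈ y≈y′ x≤y)

  +-monoʳ-≤ : ∀ {x y} z → x ≤ y → z + x ≤ z + y
  +-monoʳ-≤ z x≤y = ≤-resp-≈ (+-comm _ z) (+-comm _ z) (+-mono-≤ z x≤y)

  +-mono₂-≤ : ∀ {x y u v} → x ≤ y → u ≤ v → x + u ≤ y + v
  +-mono₂-≤ {y = y} {u = u} x≤y u≤v = ≤-trans (+-mono-≤ u x≤y) (+-monoʳ-≤ y u≤v)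

  x≤y⇒0≤y-x : ∀ {x y} → x ≤ y → 0# ≤ y - x
  x≤y⇒0≤y-x {x} x≤y = ≲-respˡ-≈ (-‿inverseʳ x) (+-mono-≤ (- x) x≤y)

  0≤y-x⇒x≤y : ∀ {x y} → 0# ≤ y - x → x ≤ y
  0≤y-x⇒x≤y {x} {y} 0≤y-x =
    ≤-resp-≈ (+-identityˡ x) (solve 2 (λ x y → y :- x :+ x := y) refl x y) (+-mono-≤ x 0≤y-x)

  *-monoˡ-≤-nonNeg : ∀ {x y z} → 0# ≤ z → x ≤ y → x * z ≤ y * z
  *-monoˡ-≤-nonNeg {x} {y} {z} 0≤z x≤y = 0≤y-x⇒x≤y (≲-respʳ-≈
    (solve 3 (λ x y z → (y :- x) :* z := y :* z :- x :* z) refl x y z)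
    (*-nonneg (x≤y⇒0≤y-x x≤y) 0≤z))

  0≤x*x : ∀ x → 0# ≤ x * x
  0≤x*x x with total 0# x
  ... | inj₁ 0≤x = *-nonneg 0≤x 0≤x
  ... | inj₂ x≤0 = ≲-respʳ-≈ (solve 1 (λ x → (:0 :- x) :* (:0 :- x) := x :* x) refl x)
                     (*-nonneg (x≤y⇒0≤y-x x≤0) (x≤y⇒0≤y-x x≤0))

  0≤1 : 0# ≤ 1#
  0≤1 = ≲-respʳ-≈ (*-identityʳ 1#) (0≤x*x 1#)

  0≤1+x : ∀ {x} → 0# ≤ x → 0# ≤ 1# + x
  0≤1+x 0≤x = ≲-respˡ-≈ (+-identityʳ 0#) (+-mono₂-≤ 0≤1 0≤x)

  0<1+x : ∀ {x} → 0# ≤ x → 0# < 1# + x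
  0<1+x {x} 0≤x = 0≤1+x 0≤x , λ 0≈1+x → 0≉1 (antisym 0≤1 (≲-respʳ-≈ (sym 0≈1+x) 1≤1+x))
    where
    1≤1+x : 1# ≤ 1# + x
    1≤1+x = ≲-respˡ-≈ (+-identityʳ 1#) (+-monoʳ-≤ 1# 0≤x)

  0≤fromℕ : ∀ n → 0# ≤ fromℕ n
  0≤fromℕ zero    = ≤-refl
  0≤fromℕ (suc n) = 0≤1+x (0≤fromℕ n)

  0<fromℕ : ∀ n .{{_ : NonZero n}} → 0# < fromℕ n
  0<fromℕ (suc n) = 0<1+x (0≤fromℕ n)

  0<2 : 0# < 2#
  0<2 = 0<1+x 0≤1

  0<x⇒x≉0 : ∀ {x} → 0# < x → ¬ x ≈ 0#
  0<x⇒x≉0 (_ , 0≉x) x≈0 = 0≉x (sym x≈0)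

  x*x⁻¹≈1 : ∀ {x} → 0# < x → x * x ⁻¹ ≈ 1#
  x*x⁻¹≈1 {x} 0<x = ⁻¹-inverse x (0<x⇒x≉0 0<x)

  x/y*y≈x : ∀ {x y} → 0# < y → x / y * y ≈ x
  x/y*y≈x {x} {y} 0<y = begin
    x * y ⁻¹ * y   ≈⟨ solve 3 (λ x y y⁻¹ → x :* y⁻¹ :* y := x :* (y :* y⁻¹)) refl x y _ ⟩
    x * (y * y ⁻¹) ≈⟨ *-congˡ (x*x⁻¹≈1 0<y) ⟩
    x * 1#         ≈⟨ *-identityʳ x ⟩
    x              ∎

  *-pos : ∀ {x y} → 0# < x → 0# < y → 0# < x * y
  *-pos {x} {y} 0<x (0≤y , 0≉y) = *-nonneg (proj₁ 0<x) 0≤y , λ 0≈xy → 0≉y (begin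
    0#              ≈⟨ zeroʳ (x ⁻¹) ⟨
    x ⁻¹ * 0#       ≈⟨ *-congˡ 0≈xy ⟩
    x ⁻¹ * (x * y)  ≈⟨ solve 3 (λ x x⁻¹ y → x⁻¹ :* (x :* y) := (x :* x⁻¹) :* y) refl x _ y ⟩
    (x * x ⁻¹) * y  ≈⟨ *-congʳ (x*x⁻¹≈1 0<x) ⟩
    1# * y          ≈⟨ *-identityˡ y ⟩
    y               ∎)

  0<x⇒0<x⁻¹ : ∀ {x} → 0# < x → 0# < x ⁻¹
  0<x⇒0<x⁻¹ {x} 0<x = 0≤x⁻¹ , λ 0≈x⁻¹ → 0≉1 (begin
    0#         ≈⟨ zeroʳ x ⟨
    x * 0#     ≈⟨ *-congˡ 0≈x⁻¹ ⟩
    x * x ⁻¹   ≈⟨ x*x⁻¹≈1 0<x ⟩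
    1#         ∎)
    where
    0≤x⁻¹ : 0# ≤ x ⁻¹
    0≤x⁻¹ = ≲-respʳ-≈ (begin
      x * (x ⁻¹ * x ⁻¹) ≈⟨ solve 2 (λ x x⁻¹ → x :* (x⁻¹ :* x⁻¹) := (x :* x⁻¹) :* x⁻¹) refl x _ ⟩
      (x * x ⁻¹) * x ⁻¹ ≈⟨ *-congʳ (x*x⁻¹≈1 0<x) ⟩
      1# * x ⁻¹         ≈⟨ *-identityˡ (x ⁻¹) ⟩
      x ⁻¹              ∎) (*-nonneg (proj₁ 0<x) (0≤x*x (x ⁻¹)))

  x<y⇒0<y-x : ∀ {x y} → x < y → 0# < y - x
  x<y⇒0<y-x {x} {y} (x≤y , x≉y) =
    x≤y⇒0≤y-x x≤y , λ 0≈y-x → x≉y (sym (x∙y⁻¹≈ε⇒x≈y y x (sym 0≈y-x)))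

  *-cancelˡ-≤-pos : ∀ {x y z} → 0# < z → z * x ≤ z * y → x ≤ y
  *-cancelˡ-≤-pos {x} {y} {z} 0<z zx≤zy =
    ≤-resp-≈ (cancel x) (cancel y) (*-monoˡ-≤-nonNeg (proj₁ (0<x⇒0<x⁻¹ 0<z)) zx≤zy)
    where
    cancel : ∀ u → z * u * z ⁻¹ ≈ u
    cancel u = trans (solve 3 (λ z u z⁻¹ → z :* u :* z⁻¹ := u :* z⁻¹ :* z) refl z u (z ⁻¹))
                     (x/y*y≈x 0<z)

  x/y≤z⇒x≤z*y : ∀ {x y z} → 0# < y → x / y ≤ z → x ≤ z * y
  x/y≤z⇒x≤z*y 0<y x/y≤z = ≲-respˡ-≈ (x/y*y≈x 0<y) (*-monoˡ-≤-nonNeg (proj₁ 0<y) x/y≤z)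

  a*d≤c*b⇒a/b≤c/d : ∀ {a b c d} → 0# < b → 0# < d → a * d ≤ c * b → a / b ≤ c / d
  a*d≤c*b⇒a/b≤c/d {a} {b} {c} {d} 0<b 0<d ad≤cb = ≤-resp-≈
    (trans (solve 4 (λ a d b⁻¹ d⁻¹ → a :* d :* (b⁻¹ :* d⁻¹) := a :* b⁻¹ :* d⁻¹ :* d)
                    refl a d (b ⁻¹) (d ⁻¹))
           (x/y*y≈x 0<d))
    (trans (solve 4 (λ c b b⁻¹ d⁻¹ → c :* b :* (b⁻¹ :* d⁻¹) := c :* d⁻¹ :* b⁻¹ :* b)
                    refl c b (b ⁻¹) (d ⁻¹))
           (x/y*y≈x 0<b))
    (*-monoˡ-≤-nonNeg (proj₁ (*-pos (0<x⇒0<x⁻¹ 0<b) (0<x⇒0<x⁻¹ 0<d))) ad≤cb)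

  <-respʳ-≈ : ∀ {x y z} → y ≈ z → x < y → x < z
  <-respʳ-≈ y≈z (x≤y , x≉y) = ≲-respʳ-≈ y≈z x≤y , λ x≈z → x≉y (trans x≈z (sym y≈z))

  x+y≤z⇒x≤z-y : ∀ {x y z} → x + y ≤ z → x ≤ z - y
  x+y≤z⇒x≤z-y {x} {y} x+y≤z =
    ≲-respˡ-≈ (solve 2 (λ x y → x :+ y :- y := x) refl x y) (+-mono-≤ (- y) x+y≤z)

module FiniteSums {c ℓ₁ ℓ₂} (F : OrderedField c ℓ₁ ℓ₂) where
  open OrderedField F
  open OrderedFieldProperties F using (+-mono₂-≤)
  open IsTotalOrder isTotalOrder using () renaming (refl to ≤-refl)
  open import Algebra.Properties.CommutativeSemigroup +-commutativeSemigroup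
    using () renaming (interchange to +-interchange)
  import Data.Fin as Fin

  ∑-mono-≤ : ∀ n {f g : Fin.Fin n → Carrier} → (∀ i → f i ≤ g i) → ∑ n f ≤ ∑ n g
  ∑-mono-≤ zero    f≤g = ≤-refl
  ∑-mono-≤ (suc n) f≤g = +-mono₂-≤ (f≤g Fin.zero) (∑-mono-≤ n (λ i → f≤g (Fin.suc i)))

  ∑-+ : ∀ n (f g : Fin.Fin n → Carrier) → ∑ n (λ i → f i + g i) ≈ ∑ n f + ∑ n g
  ∑-+ zero    f g = sym (+-identityˡ 0#)
  ∑-+ (suc n) f g = trans (+-congˡ (∑-+ n (λ i → f (Fin.suc i)) (λ i → g (Fin.suc i))))
    (+-interchange _ _ _ _)

  ∑-*ˡ : ∀ n a (f : Fin.Fin n → Carrier) → ∑ n (λ i → a * f i) ≈ a * ∑ n f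
  ∑-*ˡ zero    a f = sym (zeroʳ a)
  ∑-*ˡ (suc n) a f = trans (+-congˡ (∑-*ˡ n a (λ i → f (Fin.suc i)))) (sym (distribˡ a _ _))

  ∑-const : ∀ n x → ∑ n (λ _ → x) ≈ fromℕ n * x
  ∑-const zero    x = sym (zeroˡ x)
  ∑-const (suc n) x =
    trans (+-cong (sym (*-identityˡ x)) (∑-const n x)) (sym (distribʳ x 1# (fromℕ n)))

module RandomizedErrorRate {c ℓ₁ ℓ₂} (F : OrderedField c ℓ₁ ℓ₂) where
  open OrderedField F
  open OrderedFieldProperties F
  open FiniteSums F
  open IsTotalOrder isTotalOrder
    using (≲-respʳ-≈) renaming (reflexive to ≤-reflexive; trans to ≤-trans)
  open import Algebra.Properties.Ring ring using (+-cancelˡ)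
  open ℤ-CoefficientRingSolver commutativeRing
    using (solve; _:=_; _:+_; _:-_; _:*_; :-_; :0; :1; :2)
  open import Relation.Binary.Reasoning.Setoid setoid

  private
    variable
      a : Level
      X : Set a
      n : ℕ

  indicator : Side → Carrier → Carrier
  indicator inside  v = v
  indicator outside v = 0#

  ∑-indicator-1 : ∀ n (I : Subset n) → ∑ n (λ i → indicator (lookup I i) 1#) ≈ fromℕ ∣ I ∣
  ∑-indicator-1 zero    []            = refl
  ∑-indicator-1 (suc n) (inside ∷ I)  = +-congˡ (∑-indicator-1 n I)
  ∑-indicator-1 (suc n) (outside ∷ I) = trans (+-identityˡ _) (∑-indicator-1 n I)

  errSum : (Fin n → X × Sign) → (X → Carrier) → Subset n → Carrier
  errSum {n = n} S h̄ I =
    ∑ n (λ i → indicator (lookup I i) (radErr h̄ (proj₁ (S i)) (proj₂ (S i))))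

  -- errPr sums an indicator that is local to Defs and cannot be named here.  Prefixing the
  -- subset with inside makes the divisor fromℕ (suc ∣ I ∣), which is nonzero, so multiplying
  -- it out exposes that sum; it is then matched with errSum one sample at a time.
  errPr-inside∷ : ∀ p (S : Fin n → X × Sign) h̄ I →
    errPr (p Vector.∷ S) h̄ (inside ∷ I) * fromℕ (suc ∣ I ∣)
      ≈ radErr h̄ (proj₁ p) (proj₂ p) + errSum S h̄ I
  errPr-inside∷ {n = zero} p S h̄ [] = x/y*y≈x (0<fromℕ 1)
  errPr-inside∷ {n = suc n} p S h̄ (inside ∷ I) =
    trans (x/y*y≈x (0<fromℕ (suc ∣ inside ∷ I ∣))) (+-congˡ (+-congˡ (+-cancelˡ _ _ _
      (trans (sym (x/y*y≈x (0<fromℕ (suc ∣ I ∣)))) (errPr-inside∷ p (Vector.tail S) h̄ I)))))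
  errPr-inside∷ {n = suc n} p S h̄ (outside ∷ I) =
    trans (x/y*y≈x (0<fromℕ (suc ∣ outside ∷ I ∣))) (+-congˡ (+-congˡ (+-cancelˡ _ _ _
      (trans (sym (x/y*y≈x (0<fromℕ (suc ∣ I ∣)))) (errPr-inside∷ p (Vector.tail S) h̄ I)))))

  errPr≈errSum/∣I∣ : ∀ (S : Fin n → X × Sign) h̄ I → errPr S h̄ I ≈ errSum S h̄ I / fromℕ ∣ I ∣
  errPr≈errSum/∣I∣ {n = zero}  S h̄ [] = refl
  errPr≈errSum/∣I∣ {n = suc n} S h̄ I  = *-congʳ (+-cancelˡ _ _ _
    (trans (sym (x/y*y≈x (0<fromℕ (suc ∣ I ∣)))) (errPr-inside∷ (Vector.head S) S h̄ I)))

  2*radErr≈1-h*⟦y⟧ : ∀ (h̄ : X → Carrier) x y → 2# * radErr h̄ x y ≈ 1# - h̄ x * ⟦ y ⟧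
  2*radErr≈1-h*⟦y⟧ h̄ x Sign.+ = begin
    2# * (1# - (1# + h̄ x) * 2# ⁻¹)
      ≈⟨ solve 2 (λ h t → :2 :* (:1 :- (:1 :+ h) :* t) := :2 :- (:1 :+ h) :* (:2 :* t))
               refl (h̄ x) (2# ⁻¹) ⟩
    2# - (1# + h̄ x) * (2# * 2# ⁻¹)
      ≈⟨ +-congˡ (-‿cong (*-congˡ (x*x⁻¹≈1 0<2))) ⟩
    2# - (1# + h̄ x) * 1#
      ≈⟨ solve 1 (λ h → :2 :- (:1 :+ h) :* :1 := :1 :- h :* :1) refl (h̄ x) ⟩
    1# - h̄ x * 1# ∎
  2*radErr≈1-h*⟦y⟧ h̄ x Sign.- = begin
    2# * ((1# + h̄ x) * 2# ⁻¹)
      ≈⟨ solve 2 (λ h t → :2 :* ((:1 :+ h) :* t) := (:1 :+ h) :* (:2 :* t)) refl (h̄ x) (2# ⁻¹) ⟩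
    (1# + h̄ x) * (2# * 2# ⁻¹)
      ≈⟨ *-congˡ (x*x⁻¹≈1 0<2) ⟩
    (1# + h̄ x) * 1#
      ≈⟨ solve 1 (λ h → (:1 :+ h) :* :1 := :1 :- h :* :- :1) refl (h̄ x) ⟩
    1# - h̄ x * - 1# ∎

  lossTerm : Sign → Sign → Carrier → Carrier
  lossTerm s y h = (⟦ s ⟧ * ⟦ y ⟧) * (2# - h * ⟦ y ⟧) - h * ⟦ y ⟧

  lossTerm+2≈ : ∀ s y h → lossTerm s y h + 2# ≈ (1# + ⟦ s ⟧ * ⟦ y ⟧) * (2# - h * ⟦ y ⟧)
  lossTerm+2≈ s y h = solve 3
    (λ s y h → (s :* y) :* (:2 :- h :* y) :- h :* y :+ :2 := (:1 :+ s :* y) :* (:2 :- h :* y))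
    refl ⟦ s ⟧ ⟦ y ⟧ h

  ⟦y⟧*⟦y⟧≈1 : ∀ y → ⟦ y ⟧ * ⟦ y ⟧ ≈ 1#
  ⟦y⟧*⟦y⟧≈1 Sign.+ = *-identityˡ 1#
  ⟦y⟧*⟦y⟧≈1 Sign.- = solve 0 (:- :1 :* :- :1 := :1) refl

  0≤1+⟦s⟧*⟦y⟧ : ∀ s y → 0# ≤ 1# + ⟦ s ⟧ * ⟦ y ⟧
  0≤1+⟦s⟧*⟦y⟧ Sign.+ Sign.+ = ≲-respʳ-≈ (solve 0 (:2 := :1 :+ :1 :* :1) refl) (proj₁ 0<2)
  0≤1+⟦s⟧*⟦y⟧ Sign.- Sign.- = ≲-respʳ-≈ (solve 0 (:2 := :1 :+ :- :1 :* :- :1) refl) (proj₁ 0<2)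
  0≤1+⟦s⟧*⟦y⟧ Sign.+ Sign.- = ≤-reflexive (solve 0 (:0 := :1 :+ :1 :* :- :1) refl)
  0≤1+⟦s⟧*⟦y⟧ Sign.- Sign.+ = ≤-reflexive (solve 0 (:0 := :1 :+ :- :1 :* :1) refl)

  0≤2-h*⟦y⟧ : ∀ {h} y → - 1# ≤ h → h ≤ 1# → 0# ≤ 2# - h * ⟦ y ⟧
  0≤2-h*⟦y⟧ {h} Sign.+ _ h≤1 =
    ≲-respʳ-≈ (solve 1 (λ h → :1 :+ (:1 :- h) := :2 :- h :* :1) refl h) (0≤1+x (x≤y⇒0≤y-x h≤1))
  0≤2-h*⟦y⟧ {h} Sign.- -1≤h _ =
    ≲-respʳ-≈ (solve 1 (λ h → :1 :+ (h :- :- :1) := :2 :- h :* :- :1) refl h) (0≤1+x (x≤y⇒0≤y-x -1≤h))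

  indicator-radErr-bound : ∀ b s y (h̄ : X → Carrier) x → (b ≡ inside → s ≡ y) →
    - 1# ≤ h̄ x → h̄ x ≤ 1# →
    (2# + 2#) * indicator b (radErr h̄ x y) + 2# * indicator b 1# ≤ lossTerm s y (h̄ x) + 2#
  indicator-radErr-bound inside s y h̄ x s≡y _ _ with ≡.refl ← s≡y ≡.refl = ≤-reflexive (begin
    (2# + 2#) * radErr h̄ x y + 2# * 1#
      ≈⟨ solve 1 (λ r → (:2 :+ :2) :* r :+ :2 :* :1 := :2 :* (:2 :* r) :+ :2) refl (radErr h̄ x y) ⟩
    2# * (2# * radErr h̄ x y) + 2#
      ≈⟨ +-congʳ (*-congˡ (2*radErr≈1-h*⟦y⟧ h̄ x y)) ⟩
    2# * (1# - h̄ x * ⟦ y ⟧) + 2#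
      ≈⟨ solve 1 (λ u → :2 :* (:1 :- u) :+ :2 := (:1 :+ :1) :* (:2 :- u)) refl (h̄ x * ⟦ y ⟧) ⟩
    (1# + 1#) * (2# - h̄ x * ⟦ y ⟧)
      ≈⟨ *-congʳ (+-congˡ (⟦y⟧*⟦y⟧≈1 y)) ⟨
    (1# + ⟦ y ⟧ * ⟦ y ⟧) * (2# - h̄ x * ⟦ y ⟧)
      ≈⟨ lossTerm+2≈ y y (h̄ x) ⟨
    lossTerm y y (h̄ x) + 2# ∎)
  indicator-radErr-bound outside s y h̄ x _ -1≤h h≤1 = ≤-resp-≈
    (solve 0 (:0 := (:2 :+ :2) :* :0 :+ :2 :* :0) refl)
    (sym (lossTerm+2≈ s y (h̄ x)))
    (*-nonneg (0≤1+⟦s⟧*⟦y⟧ s y) (0≤2-h*⟦y⟧ y -1≤h h≤1))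

  lossSum : (Fin n → X × Sign) → (X → Sign) → (X → Carrier) → Carrier
  lossSum {n = n} S f h̄ =
    ∑ n (λ i → lossTerm (f (proj₁ (S i))) (proj₂ (S i)) (h̄ (proj₁ (S i))))

  errSum-bound : ∀ (S : Fin n → X × Sign) f h̄ (I : Subset n) →
    (∀ x → (- 1# ≤ h̄ x) × (h̄ x ≤ 1#)) →
    (∀ i → i ∈ I → f (proj₁ (S i)) ≡ proj₂ (S i)) →
    (2# + 2#) * errSum S h̄ I + 2# * fromℕ ∣ I ∣ ≤ lossSum S f h̄ + fromℕ n * 2#
  errSum-bound {n = n} S f h̄ I h̄-bounded f-fits-I = ≤-resp-≈
    (begin
      ∑ n (λ i → (2# + 2#) * indicator (side i) (r i) + 2# * indicator (side i) 1#)
        ≈⟨ ∑-+ n _ _ ⟩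
      ∑ n (λ i → (2# + 2#) * indicator (side i) (r i)) + ∑ n (λ i → 2# * indicator (side i) 1#)
        ≈⟨ +-cong (∑-*ˡ n _ _) (trans (∑-*ˡ n _ _) (*-congˡ (∑-indicator-1 n I))) ⟩
      (2# + 2#) * errSum S h̄ I + 2# * fromℕ ∣ I ∣ ∎)
    (trans (∑-+ n _ _) (+-congˡ (∑-const n 2#)))
    (∑-mono-≤ n λ i → indicator-radErr-bound (side i) (f (proj₁ (S i))) (proj₂ (S i)) h̄ (proj₁ (S i))
      (λ i∈I → f-fits-I i (lookup⇒[]= i I i∈I)) (proj₁ (h̄-bounded _)) (proj₂ (h̄-bounded _)))
    where
    side : Fin n → Side
    side = lookup I
    r : Fin n → Carrier
    r i = radErr h̄ (proj₁ (S i)) (proj₂ (S i))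

  4g+2m≤l+2N⇒4g≤[ε+2η]N : ∀ {g l m N ε η} → m ≈ (1# - η) * N → l ≤ ε * N →
    (2# + 2#) * g + 2# * m ≤ l + N * 2# → (2# + 2#) * g ≤ (ε + 2# * η) * N
  4g+2m≤l+2N⇒4g≤[ε+2η]N {g} {l} {m} {N} {ε} {η} m≈ l≤εN 4g+2m≤l+2N = ≲-respʳ-≈ (begin
      ε * N + N * 2# - 2# * m
        ≈⟨ +-congˡ (-‿cong (*-congˡ m≈)) ⟩
      ε * N + N * 2# - 2# * ((1# - η) * N)
        ≈⟨ solve 3 (λ ε η N → ε :* N :+ N :* :2 :- :2 :* ((:1 :- η) :* N) := (ε :+ :2 :* η) :* N)
                 refl ε η N ⟩
      (ε + 2# * η) * N ∎)
    (x+y≤z⇒x≤z-y (≤-trans 4g+2m≤l+2N (+-mono-≤ (N * 2#) l≤εN)))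

  4g≤[ε+2η]N⇒g/m≤[η+ε/2]/[2[1-η]] : ∀ {g m N ε η} → 0# < N → η < 1# → m ≈ (1# - η) * N →
    (2# + 2#) * g ≤ (ε + 2# * η) * N → g / m ≤ (η + ε / 2#) / (2# * (1# - η))
  4g≤[ε+2η]N⇒g/m≤[η+ε/2]/[2[1-η]] {g} {m} {N} {ε} {η} 0<N η<1 m≈ 4g≤[ε+2η]N =
    a*d≤c*b⇒a/b≤c/d 0<m (*-pos 0<2 0<1-η)
      (*-cancelˡ-≤-pos 0<2 (≤-resp-≈ lhs rhs (*-monoˡ-≤-nonNeg (proj₁ 0<1-η) 4g≤[ε+2η]N)))
    where
    0<1-η : 0# < 1# - η
    0<1-η = x<y⇒0<y-x η<1
    0<m : 0# < m
    0<m = <-respʳ-≈ (sym m≈) (*-pos 0<1-η 0<N)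
    lhs : (2# + 2#) * g * (1# - η) ≈ 2# * (g * (2# * (1# - η)))
    lhs = solve 2 (λ g η → (:2 :+ :2) :* g :* (:1 :- η) := :2 :* (g :* (:2 :* (:1 :- η)))) refl g η
    rhs : (ε + 2# * η) * N * (1# - η) ≈ 2# * ((η + ε / 2#) * m)
    rhs = begin
      (ε + 2# * η) * N * (1# - η)
        ≈⟨ solve 3 (λ ε η N → (ε :+ :2 :* η) :* N :* (:1 :- η)
                               := (ε :* :1 :+ :2 :* η) :* ((:1 :- η) :* N)) refl ε η N ⟩
      (ε * 1# + 2# * η) * ((1# - η) * N)
        ≈⟨ *-cong (+-congʳ (*-congˡ (x*x⁻¹≈1 0<2))) m≈ ⟨
      (ε * (2# * 2# ⁻¹) + 2# * η) * m
        ≈⟨ solve 4 (λ ε η t m → (ε :* (:2 :* t) :+ :2 :* η) :* m := :2 :* ((η :+ ε :* t) :* m))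
                 refl ε η (2# ⁻¹) m ⟩
      2# * ((η + ε / 2#) * m) ∎

claim6p2 : {c ℓ₁ ℓ₂ a : Level} (F : OrderedField c ℓ₁ ℓ₂) → let open OrderedField F in
    {X : Set a} (𝒞 : (X → Sign) → Set a)
    (n : ℕ) .{{_ : NonZero n}} (S : Fin n → X × Sign)
    (ε : Carrier) (h̄ : X → Carrier) →
    0# ≤ ε →
    (∀ x → ((- 1#) ≤ h̄ x) × (h̄ x ≤ 1#)) →
    (∀ f → 𝒞 f → loss S f h̄ ≤ ε) →
    ∀ (η : Carrier) (I : Subset n) →
    0# ≤ η → η < 1# →
    fromℕ ∣ I ∣ ≈ (1# - η) * fromℕ n →
    Σ (X → Sign) (λ f → 𝒞 f × (∀ i → i ∈ I → f (proj₁ (S i)) ≡ proj₂ (S i))) →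
    errPr S h̄ I ≤ (η + ε / 2#) / (2# * (1# - η))
claim6p2 F 𝒞 n S ε h̄ _ h̄-bounded loss≤ε η I _ η<1 ∣I∣≈[1-η]n (f , f∈𝒞 , f-fits-I) =
  ≲-respˡ-≈ (sym (errPr≈errSum/∣I∣ S h̄ I))
    (4g≤[ε+2η]N⇒g/m≤[η+ε/2]/[2[1-η]] (0<fromℕ n) η<1 ∣I∣≈[1-η]n
      (4g+2m≤l+2N⇒4g≤[ε+2η]N ∣I∣≈[1-η]n lossSum≤εn (errSum-bound S f h̄ I h̄-bounded f-fits-I)))
  where
  open OrderedField F
  open OrderedFieldProperties F using (0<fromℕ; x/y≤z⇒x≤z*y)
  open RandomizedErrorRate F
  open IsTotalOrder isTotalOrder using (≲-respˡ-≈)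

  lossSum≤εn : lossSum S f h̄ ≤ ε * fromℕ n
  lossSum≤εn = x/y≤z⇒x≤z*y (0<fromℕ n) (loss≤ε f f∈𝒞)
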